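{- Let $\mathcal{G}$ be the space of group multiplication tables on $\mathbb{N}$ with identity $1$. For every countably infinite algebraically closed group $A$, the set $\{G\in\mathcal{G}:\ \widetilde G\cong A\}$ is dense in $\mathcal{G}$.
   Context: $\mathbb{N}=\{1,2,3,\dots\}$. $\mathcal{G}\subseteq\mathbb{N}^{\mathbb{N}\times\mathbb{N}}$ (product of discrete spaces) is the subspace of those $A$ such that $(i,j)\mapsto A(i,j)$ is the multiplication of a group on $\mathbb{N}$ with identity element $1$. For $G\in\mathcal{G}$, $\widetilde G$ is the group on $\mathbb{N}$ with multiplication table $G$. A group $G$ is algebraically closed if every finite system of equations and inequations with constants from $G$ that is solvable in some group containing $G$ is solvable in $G$. -}

module Defs where

open import Level using (0ℓ)
open import Data.Nat using (ℕ; zero; suc; _<_)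
open import Data.Fin using (Fin)
open import Data.List using (List)
open import Data.List.Relation.Unary.All using (All)
open import Data.Product using (Σ; ∃; _×_; _,_; proj₁; proj₂)
open import Relation.Nullary using (¬_)
open import Relation.Binary.PropositionalEquality using (_≡_)
import Relation.Binary.PropositionalEquality as ≡
open import Algebra.Bundles using (Group)
open import Algebra.Structures using (IsGroup)
open import Algebra.Morphism.Structures using (IsGroupMonomorphism; IsGroupIsomorphism)
open import Function.Bundles using (Bijection)

-- Convention: the paper's ℕ = {1,2,3,...} is represented by Agda's ℕ
-- via the shift k ↦ k+1; so the paper's identity element 1 is 0 here.

Table : Set
Table = ℕ → ℕ → ℕ

IsGroupTable : Table → Set
IsGroupTable A = Σ (ℕ → ℕ) λ inv → IsGroup _≡_ A 0 inv

𝒢 : Set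
𝒢 = Σ Table IsGroupTable

tilde : 𝒢 → Group 0ℓ 0ℓ
tilde (A , inv , isG) = record
  { Carrier = ℕ ; _≈_ = _≡_ ; _∙_ = A ; ε = 0 ; _⁻¹ = inv ; isGroup = isG }

_≅_ : Group 0ℓ 0ℓ → Group 0ℓ 0ℓ → Set
G ≅ H = Σ (Group.Carrier G → Group.Carrier H) λ f →
          IsGroupIsomorphism (Group.rawGroup G) (Group.rawGroup H) f

CountablyInfinite : Group 0ℓ 0ℓ → Set
CountablyInfinite G = Bijection (≡.setoid ℕ) (Group.setoid G)

data Term (X : Set) (n : ℕ) : Set where
  var   : Fin n → Term X n
  const : X → Term X n
  e     : Term X n
  _·_   : Term X n → Term X n → Term X n
  inv   : Term X n → Term X n

eval : ∀ {X n} (H : Group 0ℓ 0ℓ) → (X → Group.Carrier H) →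
       (Fin n → Group.Carrier H) → Term X n → Group.Carrier H
eval H c s (var i)   = s i
eval H c s (const x) = c x
eval H c s e         = Group.ε H
eval H c s (t · u)   = Group._∙_ H (eval H c s t) (eval H c s u)
eval H c s (inv t)   = Group._⁻¹ H (eval H c s t)

SolvableIn : ∀ {X n} (H : Group 0ℓ 0ℓ) → (X → Group.Carrier H) →
             List (Term X n × Term X n) → List (Term X n × Term X n) → Set
SolvableIn H c eqs ineqs =
  ∃ λ s → All (λ p → Group._≈_ H (eval H c s (proj₁ p)) (eval H c s (proj₂ p))) eqs
        × All (λ p → ¬ Group._≈_ H (eval H c s (proj₁ p)) (eval H c s (proj₂ p))) ineqs

AlgebraicallyClosed : Group 0ℓ 0ℓ → Set₁
AlgebraicallyClosed G =
  ∀ (n : ℕ) (eqs ineqs : List (Term (Group.Carrier G) n × Term (Group.Carrier G) n)) →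
  (Σ (Group 0ℓ 0ℓ) λ H → Σ (Group.Carrier G → Group.Carrier H) λ ι →
     IsGroupMonomorphism (Group.rawGroup G) (Group.rawGroup H) ι
     × SolvableIn H ι eqs ineqs) →
  SolvableIn G (λ x → x) eqs ineqs

-- Density in 𝒢 ⊆ ℕ^(ℕ×ℕ) with the product of discrete topologies:
-- every basic open set (determined by finitely many entries, all of which
-- lie in some square [0,N)×[0,N)) meeting 𝒢 meets S.
Dense : (𝒢 → Set) → Set
Dense S = ∀ (G : 𝒢) (N : ℕ) → Σ 𝒢 λ H →
  (∀ i j → i < N → j < N → proj₁ H i j ≡ proj₁ G i j) × S H

-- Let G ∈ 𝒢 and N be given; choose M so large that the entries G(i,j) with
-- i, j < N all lie below M. In A × G̃ the elements (ε, k), k < M, are pairwise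
-- distinct and multiply like the corresponding entries of G, so by algebraic
-- closedness A contains elements a₀, …, a_{M-1} with the same properties;
-- in particular a₀a₀ = a₀, so a₀ = ε.
-- Rearranging an enumeration of A so that it starts with a₀, …, a_{M-1} and
-- transporting the multiplication of A to ℕ along it gives a table isomorphic
-- to A which agrees with G on [0,N)².
module Submission where

open import Defs
open import Level using (0ℓ)
open import Data.Nat using (ℕ; zero; suc; _<_; _⊔_)
import Data.Nat as ℕ
open import Data.Nat.Properties
  using (m<1+n⇒m<n∨m≡n; <-trans; <-≤-trans; ≤-trans; m≤m⊔n; m≤n⊔m; n<1+n; n≤1+n; 0<1+n)
open import Data.Fin using (Fin; toℕ; fromℕ; fromℕ<; inject₁)
import Data.Fin as Fin
open import Data.Fin.Properties
  using ( toℕ-injective; toℕ-fromℕ; toℕ-fromℕ<; toℕ-inject₁; toℕ-inject₁-≢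
        ; inject₁-injective; inject₁-lower₁; fromℕ≢inject₁ )
open import Data.List using (List; map; filter; cartesianProduct; allFin)
import Data.List.Relation.Unary.All as All
open import Data.List.Relation.Unary.All.Properties using (map⁺; all-filter)
open import Data.List.Membership.Propositional.Properties
  using (∈-map⁺; ∈-filter⁺; ∈-cartesianProduct⁺; ∈-allFin)
open import Data.Product using (Σ; ∃; _×_; _,_; proj₁; proj₂)
open import Data.Sum using (inj₁; inj₂)
open import Data.Empty using (⊥-elim)
open import Function using (_∘_)
open import Function.Bundles using (Inverse; Injection; Bijection; _↔_; mk↔ₛ′)
open import Function.Definitions using (Injective)
open import Function.Properties.Bijection using (Bijection⇒Inverse)
open import Function.Properties.Inverse using (Inverse⇒Injection)
import Function.Construct.Composition as Compose
open import Function.Construct.Identity using (↔-id)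
open import Relation.Nullary using (yes; no)
open import Relation.Nullary.Decidable using (¬?; decidable-stable)
import Relation.Unary as U
import Relation.Binary.Reasoning.Setoid as ≈-Reasoning
open import Relation.Binary using (Setoid; Decidable; DecidableEquality)
open import Relation.Binary.PropositionalEquality
  using (_≡_; _≢_; refl; sym; trans; cong; cong₂; subst; setoid; module ≡-Reasoning)
open import Algebra.Bundles using (Group; RawGroup)
open import Algebra.Morphism.Structures using (IsGroupMonomorphism)
import Algebra.Morphism.GroupMonomorphism as GroupMonomorphism
import Algebra.Properties.Group as GroupProperties
import Algebra.Construct.DirectProduct as DirectProduct

module Transposition {A : Set} (_≟_ : DecidableEquality A) where

  transpose : A → A → A → A
  transpose u v x with x ≟ u
  ... | yes _ = v
  ... | no _ with x ≟ v
  ...   | yes _ = u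
  ...   | no _ = x

  transpose-left : ∀ u v → transpose u v u ≡ v
  transpose-left u v with u ≟ u
  ... | yes _ = refl
  ... | no u≢u = ⊥-elim (u≢u refl)

  transpose-right : ∀ u v → transpose u v v ≡ u
  transpose-right u v with v ≟ u
  ... | yes v≡u = v≡u
  ... | no _ with v ≟ v
  ...   | yes _ = refl
  ...   | no v≢v = ⊥-elim (v≢v refl)

  transpose-fixes : ∀ {u v x} → x ≢ u → x ≢ v → transpose u v x ≡ x
  transpose-fixes {u} {v} {x} x≢u x≢v with x ≟ u
  ... | yes x≡u = ⊥-elim (x≢u x≡u)
  ... | no _ with x ≟ v
  ...   | yes x≡v = ⊥-elim (x≢v x≡v)
  ...   | no _ = refl

  transpose-involutive : ∀ u v x → transpose u v (transpose u v x) ≡ x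
  transpose-involutive u v x with x ≟ u
  ... | yes refl = transpose-right u v
  ... | no x≢u with x ≟ v
  ...   | yes refl = transpose-left u v
  ...   | no x≢v = transpose-fixes x≢u x≢v

  transposition : A → A → A ↔ A
  transposition u v =
    mk↔ₛ′ (transpose u v) (transpose u v) (transpose-involutive u v) (transpose-involutive u v)

open Transposition ℕ._≟_

permutation-extending : ∀ {M} (b : Fin M → ℕ) → Injective _≡_ _≡_ b →
                        Σ (ℕ ↔ ℕ) λ π → ∀ k → Inverse.to π (toℕ k) ≡ b k
permutation-extending {zero}  b b-inj = ↔-id ℕ , λ ()
permutation-extending {suc M} b b-inj
  with permutation-extending (b ∘ inject₁) (inject₁-injective ∘ b-inj)
... | π′ , π′-extends = π , π-extends
  where
  open Inverse π′ using () renaming (to to π′-to)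
  open Injection (Inverse⇒Injection π′) using () renaming (injective to π′-injective)

  u v : ℕ
  u = π′-to M
  v = b (fromℕ M)

  π : ℕ ↔ ℕ
  π = Compose.inverse π′ (transposition u v)

  π-extends-inject₁ : ∀ j → transpose u v (π′-to (toℕ (inject₁ j))) ≡ b (inject₁ j)
  π-extends-inject₁ j = trans (cong (transpose u v) π′-j) (transpose-fixes ≢u ≢v)
    where
    π′-j : π′-to (toℕ (inject₁ j)) ≡ b (inject₁ j)
    π′-j = trans (cong π′-to (toℕ-inject₁ j)) (π′-extends j)
    ≢u : b (inject₁ j) ≢ u
    ≢u eq = toℕ-inject₁-≢ j (sym (π′-injective (trans π′-j eq)))
    ≢v : b (inject₁ j) ≢ v
    ≢v eq = fromℕ≢inject₁ (sym (b-inj eq))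

  π-extends : ∀ k → Inverse.to π (toℕ k) ≡ b k
  π-extends k with toℕ k ℕ.≟ M
  ... | yes k≡M = begin
    transpose u v (π′-to (toℕ k))   ≡⟨ cong (transpose u v ∘ π′-to) k≡M ⟩
    transpose u v u                 ≡⟨ transpose-left u v ⟩
    b (fromℕ M)                     ≡⟨ cong b (toℕ-injective (trans (toℕ-fromℕ M) (sym k≡M))) ⟩
    b k                             ∎
    where open ≡-Reasoning
  ... | no k≢M = subst (λ k → Inverse.to π (toℕ k) ≡ b k)
                   (inject₁-lower₁ k (k≢M ∘ sym)) (π-extends-inject₁ _)

enumeration-starting-with : ∀ {S : Setoid 0ℓ 0ℓ} → Bijection (setoid ℕ) S →
  ∀ {M} (a : Fin M → Setoid.Carrier S) → Injective _≡_ (Setoid._≈_ S) a →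
  Σ (Inverse (setoid ℕ) S) λ t → ∀ k → Setoid._≈_ S (Inverse.to t (toℕ k)) (a k)
enumeration-starting-with {S} enumeration a a-inj = Compose.inverse π ν , t-extends
  where
  module S = Setoid S
  ν : Inverse (setoid ℕ) S
  ν = Bijection⇒Inverse enumeration
  open Inverse ν using (to; from; to-cong; strictlyInverseˡ)

  from∘a-injective : Injective _≡_ _≡_ (from ∘ a)
  from∘a-injective {k} {l} eq = a-inj (S.trans (S.sym (strictlyInverseˡ (a k)))
                                         (S.trans (to-cong eq) (strictlyInverseˡ (a l))))

  π : ℕ ↔ ℕ
  π = proj₁ (permutation-extending (from ∘ a) from∘a-injective)

  π-extends : ∀ k → Inverse.to π (toℕ k) ≡ from (a k)
  π-extends = proj₂ (permutation-extending (from ∘ a) from∘a-injective)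

  t-extends : ∀ k → to (Inverse.to π (toℕ k)) S.≈ a k
  t-extends k = S.trans (to-cong (π-extends k)) (strictlyInverseˡ (a k))

module Transport (A : Group 0ℓ 0ℓ) (t : Inverse (setoid ℕ) (Group.setoid A))
                 (t-0 : Group._≈_ A (Inverse.to t 0) (Group.ε A)) where
  open Group A using (_≈_; _∙_; _⁻¹; rawGroup; isGroup)
  open Inverse t

  transportedRawGroup : RawGroup 0ℓ 0ℓ
  transportedRawGroup = record
    { Carrier = ℕ ; _≈_ = _≡_ ; _∙_ = λ i j → from (to i ∙ to j) ; ε = 0
    ; _⁻¹ = λ i → from (to i ⁻¹) }

  to-isGroupMonomorphism : IsGroupMonomorphism transportedRawGroup rawGroup to
  to-isGroupMonomorphism = record
    { isGroupHomomorphism = record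
      { isMonoidHomomorphism = record
        { isMagmaHomomorphism = record
          { isRelHomomorphism = record { cong = to-cong }
          ; homo = λ i j → strictlyInverseˡ (to i ∙ to j) }
        ; ε-homo = t-0 }
      ; ⁻¹-homo = λ i → strictlyInverseˡ (to i ⁻¹) }
    ; injective = Injection.injective (Inverse⇒Injection t) }

  transported : 𝒢
  transported = _ , _ , GroupMonomorphism.isGroup to-isGroupMonomorphism isGroup

  transported-≅ : tilde transported ≅ A
  transported-≅ = to , record
    { isGroupMonomorphism = to-isGroupMonomorphism
    ; surjective = λ y → from y , inverseˡ }

  transported-∙ : ∀ {i j k} → to i ∙ to j ≈ to k → proj₁ transported i j ≡ k
  transported-∙ {k = k} eq = trans (from-cong eq) (strictlyInverseʳ k)

module _ (A B : Group 0ℓ 0ℓ) where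
  private
    module A = Group A
    module B = Group B
    A×B = DirectProduct.group A B

  inj₁-isGroupMonomorphism :
    IsGroupMonomorphism A.rawGroup (Group.rawGroup A×B) (λ a → a , B.ε)
  inj₁-isGroupMonomorphism = record
    { isGroupHomomorphism = record
      { isMonoidHomomorphism = record
        { isMagmaHomomorphism = record
          { isRelHomomorphism = record { cong = λ eq → eq , B.refl }
          ; homo = λ _ _ → A.refl , B.sym (B.identityˡ B.ε) }
        ; ε-homo = A.refl , B.refl }
      ; ⁻¹-homo = λ _ → A.refl , B.sym (GroupProperties.ε⁻¹≈ε B) }
    ; injective = proj₁ }

  finite-configuration-embeds :
    AlgebraicallyClosed A → Decidable B._≈_ →
    ∀ {M} (x : Fin M → B.Carrier) → Injective _≡_ B._≈_ x →
    ∃ λ (a : Fin M → A.Carrier) → Injective _≡_ A._≈_ a ×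
      (∀ k l m → x k B.∙ x l B.≈ x m → a k A.∙ a l A.≈ a m)
  finite-configuration-embeds closed _≟_ {M} x x-inj = a , a-inj , a-∙
    where
    pairs : List (Fin M × Fin M)
    pairs = cartesianProduct (allFin M) (allFin M)

    triples : List (Fin M × Fin M × Fin M)
    triples = cartesianProduct (allFin M) pairs

    Relation : Fin M × Fin M × Fin M → Set
    Relation (k , l , m) = x k B.∙ x l B.≈ x m

    relation? : U.Decidable Relation
    relation? (k , l , m) = (x k B.∙ x l) ≟ x m

    Distinct : Fin M × Fin M → Set
    Distinct (k , l) = k ≢ l

    distinct? : U.Decidable Distinct
    distinct? (k , l) = ¬? (k Fin.≟ l)

    relations : List (Fin M × Fin M × Fin M)
    relations = filter relation? triples

    distinct : List (Fin M × Fin M)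
    distinct = filter distinct? pairs

    equation : Fin M × Fin M × Fin M → Term A.Carrier M × Term A.Carrier M
    equation (k , l , m) = var k · var l , var m

    inequation : Fin M × Fin M → Term A.Carrier M × Term A.Carrier M
    inequation (k , l) = var k , var l

    solved-in-A×B : SolvableIn A×B (λ a → a , B.ε) (map equation relations) (map inequation distinct)
    solved-in-A×B = (λ k → A.ε , x k)
      , map⁺ (All.map (λ r → A.identityˡ A.ε , r) (all-filter relation? triples))
      , map⁺ (All.map (λ k≢l eq → k≢l (x-inj (proj₂ eq))) (all-filter distinct? pairs))

    solution : SolvableIn A (λ a → a) (map equation relations) (map inequation distinct)
    solution = closed M (map equation relations) (map inequation distinct)
                 (A×B , _ , inj₁-isGroupMonomorphism , solved-in-A×B)

    a : Fin M → A.Carrier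
    a = proj₁ solution

    a-inj : Injective _≡_ A._≈_ a
    a-inj {k} {l} eq = decidable-stable (k Fin.≟ l) λ k≢l →
      All.lookup (proj₂ (proj₂ solution))
        (∈-map⁺ inequation (∈-filter⁺ distinct? (∈-cartesianProduct⁺ (∈-allFin k) (∈-allFin l)) k≢l)) eq

    a-∙ : ∀ k l m → Relation (k , l , m) → a k A.∙ a l A.≈ a m
    a-∙ k l m r = All.lookup (proj₁ (proj₂ solution))
      (∈-map⁺ equation (∈-filter⁺ relation?
        (∈-cartesianProduct⁺ (∈-allFin k) (∈-cartesianProduct⁺ (∈-allFin l) (∈-allFin m))) r))

bounded-on-segment : (h : ℕ → ℕ) (N : ℕ) → ∃ λ B → ∀ {i} → i < N → h i < B
bounded-on-segment h zero = 0 , λ ()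
bounded-on-segment h (suc N) with bounded-on-segment h N
... | B , h<B = suc (h N) ⊔ B , h<B′
  where
  h<B′ : ∀ {i} → i < suc N → h i < suc (h N) ⊔ B
  h<B′ i<1+N with m<1+n⇒m<n∨m≡n i<1+N
  ... | inj₁ i<N = <-≤-trans (h<B i<N) (m≤n⊔m _ B)
  ... | inj₂ refl = <-≤-trans (n<1+n (h N)) (m≤m⊔n _ B)

bounded-on-square : (f : ℕ → ℕ → ℕ) (N : ℕ) → ∃ λ B → ∀ {i j} → i < N → j < N → f i j < B
bounded-on-square f N = proj₁ rows , λ i<N j<N → <-trans (proj₂ (row _) j<N) (proj₂ rows i<N)
  where
  row : ∀ i → ∃ λ B → ∀ {j} → j < N → f i j < B
  row i = bounded-on-segment (f i) N

  rows : ∃ λ B → ∀ {i} → i < N → proj₁ (row i) < B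
  rows = bounded-on-segment (proj₁ ∘ row) N

enumeration-respecting-table :
  (A : Group 0ℓ 0ℓ) → CountablyInfinite A → AlgebraicallyClosed A → (G : 𝒢) (M : ℕ) →
  Σ (Inverse (setoid ℕ) (Group.setoid A)) λ t → let open Group A; open Inverse t in
    ∀ {i j k} → i < M → j < M → k < M → proj₁ G i j ≡ k → to i ∙ to j ≈ to k
enumeration-respecting-table A enumeration closed G M
  with finite-configuration-embeds A (tilde G) closed ℕ._≟_ {M} toℕ toℕ-injective
... | a , a-inj , a-∙ with enumeration-starting-with enumeration a a-inj
...   | t , t-extends = t , t-∙
  where
  open Group A using (_≈_; _∙_; ∙-cong)
  open ≈-Reasoning (Group.setoid A)
  open Inverse t using (to)

  t-at : ∀ {i} (i<M : i < M) → to i ≈ a (fromℕ< i<M)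
  t-at {i} i<M = begin
    to i                    ≡⟨ cong to (sym (toℕ-fromℕ< i<M)) ⟩
    to (toℕ (fromℕ< i<M))   ≈⟨ t-extends (fromℕ< i<M) ⟩
    a (fromℕ< i<M)          ∎

  t-∙ : ∀ {i j k} → i < M → j < M → k < M → proj₁ G i j ≡ k → to i ∙ to j ≈ to k
  t-∙ {i} {j} {k} i<M j<M k<M ij≡k = begin
    to i ∙ to j                       ≈⟨ ∙-cong (t-at i<M) (t-at j<M) ⟩
    a (fromℕ< i<M) ∙ a (fromℕ< j<M)   ≈⟨ a-∙ _ _ _ in-table ⟩
    a (fromℕ< k<M)                    ≈⟨ t-at k<M ⟨
    to k                              ∎
    where
    in-table : proj₁ G (toℕ (fromℕ< i<M)) (toℕ (fromℕ< j<M)) ≡ toℕ (fromℕ< k<M)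
    in-table = trans (cong₂ (proj₁ G) (toℕ-fromℕ< i<M) (toℕ-fromℕ< j<M))
                     (trans ij≡k (sym (toℕ-fromℕ< k<M)))

theorem3p13 : (A : Group 0ℓ 0ℓ) → CountablyInfinite A → AlgebraicallyClosed A →
    Dense (λ G → tilde G ≅ A)
theorem3p13 A enumeration closed G N with bounded-on-square (proj₁ G) N
... | B , entry<B with enumeration-respecting-table A enumeration closed G (suc N ⊔ B)
...   | t , t-∙ = transported , agrees , transported-≅
  where
  M : ℕ
  M = suc N ⊔ B

  0<M : 0 < M
  0<M = <-≤-trans (0<1+n {N}) (m≤m⊔n (suc N) B)

  below-M : ∀ {i} → i < N → i < M
  below-M i<N = <-≤-trans i<N (≤-trans (n≤1+n N) (m≤m⊔n (suc N) B))

  entry-below-M : ∀ {i j} → i < N → j < N → proj₁ G i j < M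
  entry-below-M i<N j<N = <-≤-trans (entry<B i<N j<N) (m≤n⊔m (suc N) B)

  open Inverse t using (to)

  t-0 : Group._≈_ A (to 0) (Group.ε A)
  t-0 = GroupProperties.identityˡ-unique A (to 0) (to 0)
          (t-∙ 0<M 0<M 0<M (Group.identityˡ (tilde G) 0))

  open Transport A t t-0

  agrees : ∀ i j → i < N → j < N → proj₁ transported i j ≡ proj₁ G i j
  agrees i j i<N j<N = transported-∙ (t-∙ (below-M i<N) (below-M j<N) (entry-below-M i<N j<N) refl)
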